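{- Let $i\ge1$ and consider a solution $x\in\mathbb{N}^n$ with $\|x\|_1\le 2^i$. Then there are $x_1,x_2\in\mathbb{N}^n$ such that: (1) $\|x_1\|_1,\|x_2\|_1\le 2^{i-1}$ and $x=x_1+x_2$; (2) $|w(x_1)-\tfrac12 w(x)|\le 2\Delta$ and $|w(x_2)-\tfrac12 w(x)|\le2\Delta$; (3) $|p(x_1)-\tfrac12 p(x)|\le 2\Delta$ and $|p(x_2)-\tfrac12 p(x)|\le 2\Delta$.
   Context: Fix an \textsc{Unbounded Knapsack} item set $(p_1,w_1),\dots,(p_n,w_n)$ with $p_j,w_j\in\mathbb{N}$. For $x\in\mathbb{N}^n$, $p(x)=\sum_j p_jx_j$, $w(x)=\sum_jw_jx_j$, $\|x\|_1=\sum_jx_j$. $\Delta:=p_{\max}+w_{\max}$, where $p_{\max}=\max_jp_j$ and $w_{\max}=\max_jw_j$. -}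

module Defs where

open import Data.Nat using (ℕ; zero; suc; _+_; _*_; _⊔_)
open import Data.Fin using (Fin; zero; suc)
open import Data.Integer using (ℤ; +_; _-_; ∣_∣)

Σᶠ : (n : ℕ) → (Fin n → ℕ) → ℕ
Σᶠ zero    f = 0
Σᶠ (suc n) f = f zero + Σᶠ n (λ j → f (suc j))

maxᶠ : (n : ℕ) → (Fin n → ℕ) → ℕ
maxᶠ zero    f = 0
maxᶠ (suc n) f = f zero ⊔ maxᶠ n (λ j → f (suc j))

norm1 : {n : ℕ} → (Fin n → ℕ) → ℕ
norm1 {n} x = Σᶠ n x

dot : {n : ℕ} → (Fin n → ℕ) → (Fin n → ℕ) → ℕ
dot {n} a x = Σᶠ n (λ j → a j * x j)

Δ : {n : ℕ} → (Fin n → ℕ) → (Fin n → ℕ) → ℕ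
Δ {n} p w = maxᶠ n p + maxᶠ n w

-- |a - b/2| ≤ c  expressed without fractions as  |2a - b| ≤ 2c
closeToHalf : ℕ → ℕ → ℕ → Set
closeToHalf a b c = ∣ (+ (2 * a)) - (+ b) ∣ Data.Nat.≤ 2 * c

-- List the items of x with repetition, sorted by weight, and pair them off consecutively;
-- one item of each pair goes to either half, so the halves get ⌈‖x‖₁/2⌉ and ⌊‖x‖₁/2⌋
-- items. Build the halves from the light end. However a pair (a, b) with w_b ≤ w_a is
-- oriented, it changes the weight difference d of the halves, where |d| ≤ w_b, by
-- ±(w_a − w_b), so |d| stays below the heaviest weight used. The orientations are thus
-- free to balance profits greedily (the less profitable half takes the more profitable
-- item), keeping the profit difference at most p_max. Both differences are then at most Δ,
-- and 2 p(x₁) − p(x) = p(x₁) − p(x₂).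

module Submission where

open import Defs
open import Data.Nat using (ℕ; _+_; _*_; _^_; _≤_; _∸_)
open import Data.Fin using (Fin)
open import Data.Product using (Σ; _×_; _,_)
open import Relation.Binary.PropositionalEquality using (_≡_)

open import Data.Nat using (zero; suc; z≤n; s≤s; ⌊_/2⌋; ⌈_/2⌉)
open import Data.Nat.Properties
open import Data.Nat.ListAction using (sum)
open import Data.Nat.ListAction.Properties using (sum-++; sum-↭)
open import Data.Fin using (zero; suc)
import Data.Integer as ℤ
open import Data.Integer using (_⊖_; ∣_∣)
open import Data.Integer.Properties using ([+m]-[+n]≡m⊖n; +-cancelˡ-⊖; ∣⊖∣-≤; ∣m⊖n∣≡∣n⊖m∣)
open import Data.List using (List; []; _∷_; _++_; map; replicate; length)
open import Data.List.Properties using (map-++; map-∘)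
open import Data.List.Relation.Unary.All as All using (All; _∷_)
open import Data.List.Relation.Unary.Linked using (Linked; _∷_; tail)
open import Data.List.Relation.Unary.Linked.Properties using (Linked⇒All)
open import Data.List.Relation.Binary.Permutation.Propositional using (_↭_; ↭-refl; ↭-sym; prep; swap; ↭-trans)
open import Data.List.Relation.Binary.Permutation.Propositional.Properties using (map⁺; shift; ↭-length; All-resp-↭)
open import Data.Product using (proj₁; proj₂)
open import Data.Sum using (_⊎_; inj₁; inj₂)
open import Relation.Binary.PropositionalEquality using (refl; sym; trans; cong; cong₂; subst; subst₂; module ≡-Reasoning)
open import Algebra.Properties.CommutativeSemigroup +-commutativeSemigroup using (interchange)
open import Function using (flip)
import Data.List.Sort
import Relation.Binary.Construct.Flip.EqAndOrd as Flip
import Relation.Binary.Construct.On as On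

private
  variable
    n k l m x y s t : ℕ

Near : ℕ → ℕ → ℕ → Set
Near k x y = x ≤ y + k × y ≤ x + k

near-sym : Near k x y → Near k y x
near-sym (x≤y+k , y≤x+k) = y≤x+k , x≤y+k

near-mono : k ≤ l → Near k x y → Near l x y
near-mono k≤l (x≤y+k , y≤x+k) =
  ≤-trans x≤y+k (+-monoʳ-≤ _ k≤l) , ≤-trans y≤x+k (+-monoʳ-≤ _ k≤l)

near-+-sorted : Near m x y → m ≤ t → t ≤ s → Near s (s + x) (t + y)
near-+-sorted {m} {x} {y} {t} {s} (x≤y+m , y≤x+m) m≤t t≤s = left , right
  where
  open ≤-Reasoning
  left : s + x ≤ t + y + s
  left = begin
    s + x       ≤⟨ +-monoʳ-≤ s (≤-trans x≤y+m (+-monoʳ-≤ y m≤t)) ⟩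
    s + (y + t) ≡⟨ +-comm s (y + t) ⟩
    y + t + s   ≡⟨ cong (_+ s) (+-comm y t) ⟩
    t + y + s   ∎
  right : t + y ≤ s + x + s
  right = begin
    t + y       ≤⟨ +-mono-≤ t≤s (≤-trans y≤x+m (+-monoʳ-≤ x (≤-trans m≤t t≤s))) ⟩
    s + (x + s) ≡⟨ +-assoc s x s ⟨
    s + x + s   ∎

near-+-≤ : x ≤ y → t ≤ s → s ≤ k → Near k x y → Near k (s + x) (t + y)
near-+-≤ {x} {y} {t} {s} {k} x≤y t≤s s≤k (_ , y≤x+k) = left , right
  where
  open ≤-Reasoning
  left : s + x ≤ t + y + k
  left = begin
    s + x     ≤⟨ +-mono-≤ s≤k x≤y ⟩
    k + y     ≡⟨ +-comm k y ⟩
    y + k     ≤⟨ +-monoˡ-≤ k (m≤n+m y t) ⟩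
    t + y + k ∎
  right : t + y ≤ s + x + k
  right = begin
    t + y       ≤⟨ +-mono-≤ t≤s y≤x+k ⟩
    s + (x + k) ≡⟨ +-assoc s x k ⟨
    s + x + k   ∎

near-+-balance : s ≤ k → t ≤ k → Near k x y →
                 Near k (s + x) (t + y) ⊎ Near k (t + x) (s + y)
near-+-balance {s} {k} {t} {x} {y} s≤k t≤k xy with ≤-total x y | ≤-total t s
... | inj₁ x≤y | inj₁ t≤s = inj₁ (near-+-≤ x≤y t≤s s≤k xy)
... | inj₁ x≤y | inj₂ s≤t = inj₂ (near-+-≤ x≤y s≤t t≤k xy)
... | inj₂ y≤x | inj₁ t≤s = inj₂ (near-sym (near-+-≤ y≤x t≤s s≤k (near-sym xy)))
... | inj₂ y≤x | inj₂ s≤t = inj₁ (near-sym (near-+-≤ y≤x s≤t t≤k (near-sym xy)))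

module _ {A : Set} (f g : A → ℕ) {P : ℕ} (f≤P : ∀ a → f a ≤ P) where

  record Halves (L : List A) (M : ℕ) : Set where
    field
      left right   : List A
      left++right↭ : left ++ right ↭ L
      length-left  : length left ≡ ⌈ length L /2⌉
      length-right : length right ≡ ⌊ length L /2⌋
      near-f       : Near P (sum (map f left)) (sum (map f right))
      near-g       : Near M (sum (map g left)) (sum (map g right))

  halves-∷-pair : ∀ {a b L M} → g b ≤ g a → g a ≤ M → Halves L (g b) → Halves (a ∷ b ∷ L) M
  halves-∷-pair {a} {b} gb≤ga ga≤M H with near-+-balance (f≤P a) (f≤P b) (Halves.near-f H)
  ... | inj₁ balanced = record
    { left = a ∷ left ; right = b ∷ right
    ; left++right↭ = ↭-trans (prep a (shift b left right)) (prep a (prep b left++right↭))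
    ; length-left = cong suc length-left ; length-right = cong suc length-right
    ; near-f = balanced
    ; near-g = near-mono ga≤M (near-+-sorted near-g ≤-refl gb≤ga) }
    where open Halves H
  ... | inj₂ balanced = record
    { left = b ∷ left ; right = a ∷ right
    ; left++right↭ = ↭-trans (prep b (shift a left right)) (swap b a left++right↭)
    ; length-left = cong suc length-left ; length-right = cong suc length-right
    ; near-f = balanced
    ; near-g = near-mono ga≤M (near-sym (near-+-sorted (near-sym near-g) ≤-refl gb≤ga)) }
    where open Halves H

  halves-sorted : ∀ {M} L → Linked (λ a b → g b ≤ g a) L → All (λ a → g a ≤ M) L → Halves L M
  halves-sorted [] _ _ = record
    { left = [] ; right = [] ; left++right↭ = ↭-refl ; length-left = refl ; length-right = refl
    ; near-f = z≤n , z≤n ; near-g = z≤n , z≤n }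
  halves-sorted (a ∷ []) _ (ga≤M ∷ _) = record
    { left = a ∷ [] ; right = [] ; left++right↭ = ↭-refl ; length-left = refl ; length-right = refl
    ; near-f = singleton (f≤P a) ; near-g = singleton ga≤M }
    where
    singleton : x ≤ k → Near k (x + 0) 0
    singleton {x} x≤k = subst (_≤ _) (sym (+-identityʳ x)) x≤k , z≤n
  halves-sorted (a ∷ b ∷ L) (gb≤ga ∷ sorted) (ga≤M ∷ _) =
    halves-∷-pair gb≤ga ga≤M
      (halves-sorted L (tail sorted) (All.tail (Linked⇒All (flip ≤-trans) ≤-refl sorted)))

  halves : ∀ {M} L → All (λ a → g a ≤ M) L → Halves L M
  halves L g≤M = record
    { left = left ; right = right
    ; left++right↭ = ↭-trans left++right↭ (sort-↭ L)
    ; length-left = trans length-left (cong ⌈_/2⌉ (↭-length (sort-↭ L)))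
    ; length-right = trans length-right (cong ⌊_/2⌋ (↭-length (sort-↭ L)))
    ; near-f = near-f ; near-g = near-g }
    where
    open Data.List.Sort (On.decTotalOrder (Flip.decTotalOrder ≤-decTotalOrder) g)
      using (sort; sort-↭; sort-↗)
    open Halves (halves-sorted (sort L) (sort-↗ L) (All-resp-↭ (↭-sym (sort-↭ L)) g≤M))

  length-halves-≤ : ∀ {L M m} (H : Halves L M) → length L ≤ 2 * m →
                    length (Halves.left H) ≤ m × length (Halves.right H) ≤ m
  length-halves-≤ {L} {m = m} H L≤2m = left≤m , ≤-trans right≤left left≤m
    where
    open Halves H
    open ≤-Reasoning
    left≤m : length left ≤ m
    left≤m = begin
      length left         ≡⟨ length-left ⟩
      ⌈ length L /2⌉      ≤⟨ ⌈n/2⌉-mono L≤2m ⟩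
      ⌈ m + (m + 0) /2⌉   ≡⟨ cong (λ m′ → ⌈ m + m′ /2⌉) (+-identityʳ m) ⟩
      ⌈ m + m /2⌉         ≡⟨ n≡⌈n+n/2⌉ m ⟨
      m                   ∎
    right≤left : length right ≤ length left
    right≤left = begin
      length right    ≡⟨ length-right ⟩
      ⌊ length L /2⌋  ≤⟨ ⌊n/2⌋≤⌈n/2⌉ (length L) ⟩
      ⌈ length L /2⌉  ≡⟨ length-left ⟨
      length left     ∎

Σᶠ-cong : ∀ n {f g : Fin n → ℕ} → (∀ j → f j ≡ g j) → Σᶠ n f ≡ Σᶠ n g
Σᶠ-cong zero    f≗g = refl
Σᶠ-cong (suc n) f≗g = cong₂ _+_ (f≗g zero) (Σᶠ-cong n (λ j → f≗g (suc j)))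

Σᶠ-distrib-+ : ∀ n (f g : Fin n → ℕ) → Σᶠ n (λ j → f j + g j) ≡ Σᶠ n f + Σᶠ n g
Σᶠ-distrib-+ zero    f g = refl
Σᶠ-distrib-+ (suc n) f g = begin
  f zero + g zero + Σᶠ n (λ j → f (suc j) + g (suc j))
    ≡⟨ cong (f zero + g zero +_) (Σᶠ-distrib-+ n (λ j → f (suc j)) (λ j → g (suc j))) ⟩
  f zero + g zero + (Σᶠ n (λ j → f (suc j)) + Σᶠ n (λ j → g (suc j)))
    ≡⟨ interchange (f zero) (g zero) _ _ ⟩
  f zero + Σᶠ n (λ j → f (suc j)) + (g zero + Σᶠ n (λ j → g (suc j))) ∎
  where open ≡-Reasoning

≤-maxᶠ : ∀ n (f : Fin n → ℕ) j → f j ≤ maxᶠ n f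
≤-maxᶠ (suc n) f zero    = m≤m⊔n _ _
≤-maxᶠ (suc n) f (suc j) = ≤-trans (≤-maxᶠ n (λ j → f (suc j)) j) (m≤n⊔m (f zero) _)

δ : Fin n → Fin n → ℕ
δ zero    zero    = 1
δ zero    (suc _) = 0
δ (suc _) zero    = 0
δ (suc i) (suc j) = δ i j

dot-zeroʳ : ∀ {n} (a : Fin n → ℕ) → dot a (λ _ → 0) ≡ 0
dot-zeroʳ {zero}  a = refl
dot-zeroʳ {suc n} a = cong₂ _+_ (*-zeroʳ (a zero)) (dot-zeroʳ (λ j → a (suc j)))

dot-δ : ∀ {n} (a : Fin n → ℕ) i → dot a (δ i) ≡ a i
dot-δ {suc n} a zero    =
  trans (cong₂ _+_ (*-identityʳ (a zero)) (dot-zeroʳ (λ j → a (suc j)))) (+-identityʳ (a zero))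
dot-δ {suc n} a (suc i) = cong₂ _+_ (*-zeroʳ (a zero)) (dot-δ (λ j → a (suc j)) i)

dot-distribʳ-+ : ∀ {n} (a x y : Fin n → ℕ) → dot a (λ j → x j + y j) ≡ dot a x + dot a y
dot-distribʳ-+ {n} a x y =
  trans (Σᶠ-cong n (λ j → *-distribˡ-+ (a j) (x j) (y j))) (Σᶠ-distrib-+ n _ _)

count : List (Fin n) → Fin n → ℕ
count L j = sum (map (λ i → δ i j) L)

count-++ : (L L′ : List (Fin n)) (j : Fin n) → count (L ++ L′) j ≡ count L j + count L′ j
count-++ L L′ j = trans (cong sum (map-++ _ L L′)) (sum-++ (map _ L) (map _ L′))

count-↭ : {L L′ : List (Fin n)} → L ↭ L′ → ∀ j → count L j ≡ count L′ j
count-↭ L↭L′ j = sum-↭ (map⁺ _ L↭L′)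

dot-count : ∀ {n} (a : Fin n → ℕ) L → dot a (count L) ≡ sum (map a L)
dot-count a []      = dot-zeroʳ a
dot-count a (i ∷ L) = begin
  dot a (λ j → δ i j + count L j)  ≡⟨ dot-distribʳ-+ a (δ i) (count L) ⟩
  dot a (δ i) + dot a (count L)    ≡⟨ cong₂ _+_ (dot-δ a i) (dot-count a L) ⟩
  a i + sum (map a L)              ∎
  where open ≡-Reasoning

norm1-count : ∀ {n} (L : List (Fin n)) → norm1 (count L) ≡ length L
norm1-count {n} L = begin
  norm1 (count L)          ≡⟨ Σᶠ-cong n (λ j → sym (*-identityˡ (count L j))) ⟩
  dot (λ _ → 1) (count L)  ≡⟨ dot-count (λ _ → 1) L ⟩
  sum (map (λ _ → 1) L)    ≡⟨ sum-ones L ⟩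
  length L                 ∎
  where
  open ≡-Reasoning
  sum-ones : ∀ L → sum (map (λ (_ : Fin n) → 1) L) ≡ length L
  sum-ones []      = refl
  sum-ones (_ ∷ L) = cong suc (sum-ones L)

items : ∀ {n} → (Fin n → ℕ) → List (Fin n)
items {zero}  x = []
items {suc n} x = replicate (x zero) zero ++ map suc (items (λ j → x (suc j)))

count-replicate-zero : ∀ m → count (replicate m (zero {n})) zero ≡ m
count-replicate-zero zero    = refl
count-replicate-zero (suc m) = cong suc (count-replicate-zero m)

count-replicate-suc : ∀ m (j : Fin n) → count (replicate m zero) (suc j) ≡ 0
count-replicate-suc zero    j = refl
count-replicate-suc (suc m) j = count-replicate-suc m j

count-map-suc-zero : (L : List (Fin n)) → count (map suc L) zero ≡ 0
count-map-suc-zero []      = refl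
count-map-suc-zero (_ ∷ L) = count-map-suc-zero L

count-map-suc : (L : List (Fin n)) (j : Fin n) → count (map suc L) (suc j) ≡ count L j
count-map-suc L j = cong sum (sym (map-∘ L))

count-items : ∀ {n} (x : Fin n → ℕ) j → count (items x) j ≡ x j
count-items {suc n} x zero = begin
  count (replicate (x zero) zero ++ map suc rest) zero
    ≡⟨ count-++ (replicate (x zero) zero) (map suc rest) zero ⟩
  count (replicate (x zero) zero) zero + count (map suc rest) zero
    ≡⟨ cong₂ _+_ (count-replicate-zero (x zero)) (count-map-suc-zero rest) ⟩
  x zero + 0
    ≡⟨ +-identityʳ (x zero) ⟩
  x zero ∎
  where
  open ≡-Reasoning
  rest : List (Fin n)
  rest = items (λ j → x (suc j))
count-items {suc n} x (suc j) = begin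
  count (replicate (x zero) zero ++ map suc rest) (suc j)
    ≡⟨ count-++ (replicate (x zero) zero) (map suc rest) (suc j) ⟩
  count (replicate (x zero) zero) (suc j) + count (map suc rest) (suc j)
    ≡⟨ cong₂ _+_ (count-replicate-suc (x zero) j) (count-map-suc rest j) ⟩
  count rest j
    ≡⟨ count-items (λ j → x (suc j)) j ⟩
  x (suc j) ∎
  where
  open ≡-Reasoning
  rest : List (Fin n)
  rest = items (λ j → x (suc j))

near⇒∣⊖∣≤ : Near k x y → ∣ x ⊖ y ∣ ≤ k
near⇒∣⊖∣≤ {k} {x} {y} (x≤y+k , y≤x+k) with ≤-total x y
... | inj₁ x≤y = subst (_≤ k) (sym (∣⊖∣-≤ x≤y)) (m≤n+o⇒m∸n≤o y x y≤x+k)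
... | inj₂ y≤x = subst (_≤ k) (sym (trans (∣m⊖n∣≡∣n⊖m∣ x y) (∣⊖∣-≤ y≤x))) (m≤n+o⇒m∸n≤o x y x≤y+k)

near⇒closeToHalf : ∀ {a b c D} → c ≡ a + b → Near k a b → k ≤ 2 * D → closeToHalf a c D
near⇒closeToHalf {k} {a} {b} refl ab k≤2D = ≤-trans (≤-reflexive ∣2a-[a+b]∣≡∣a⊖b∣) (≤-trans (near⇒∣⊖∣≤ ab) k≤2D)
  where
  open ≡-Reasoning
  ∣2a-[a+b]∣≡∣a⊖b∣ : ∣ ℤ.+ (2 * a) ℤ.- ℤ.+ (a + b) ∣ ≡ ∣ a ⊖ b ∣
  ∣2a-[a+b]∣≡∣a⊖b∣ = begin
    ∣ ℤ.+ (2 * a) ℤ.- ℤ.+ (a + b) ∣  ≡⟨ cong ∣_∣ ([+m]-[+n]≡m⊖n (2 * a) (a + b)) ⟩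
    ∣ 2 * a ⊖ (a + b) ∣        ≡⟨ cong (λ z → ∣ a + z ⊖ (a + b) ∣) (+-identityʳ a) ⟩
    ∣ a + a ⊖ (a + b) ∣        ≡⟨ cong ∣_∣ (+-cancelˡ-⊖ a a b) ⟩
    ∣ a ⊖ b ∣                  ∎

length-items : ∀ {n} (x : Fin n → ℕ) → length (items x) ≡ norm1 x
length-items {n} x = trans (sym (norm1-count (items x))) (Σᶠ-cong n (count-items x))

halves⇒closeToHalf : ∀ {n K} D (a x : Fin n → ℕ) (L₁ L₂ : List (Fin n)) →
                     (∀ j → x j ≡ count L₁ j + count L₂ j) →
                     Near K (sum (map a L₁)) (sum (map a L₂)) → K ≤ 2 * D →
                     closeToHalf (dot a (count L₁)) (dot a x) D ×
                     closeToHalf (dot a (count L₂)) (dot a x) D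
halves⇒closeToHalf {n} {K} D a x L₁ L₂ x≗L₁+L₂ near K≤2D =
  near⇒closeToHalf {D = D} dot-x near′ K≤2D ,
  near⇒closeToHalf {D = D} (trans dot-x (+-comm (dot a (count L₁)) _)) (near-sym near′) K≤2D
  where
  near′ : Near K (dot a (count L₁)) (dot a (count L₂))
  near′ = subst₂ (Near K) (sym (dot-count a L₁)) (sym (dot-count a L₂)) near
  dot-x : dot a x ≡ dot a (count L₁) + dot a (count L₂)
  dot-x = trans (Σᶠ-cong n (λ j → cong (a j *_) (x≗L₁+L₂ j))) (dot-distribʳ-+ a (count L₁) (count L₂))

lemma3p3 : (n : ℕ) (p w : Fin n → ℕ) (i : ℕ) → 1 ≤ i →
    (x : Fin n → ℕ) → norm1 x ≤ 2 ^ i →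
    Σ (Fin n → ℕ) λ x₁ → Σ (Fin n → ℕ) λ x₂ →
      (norm1 x₁ ≤ 2 ^ (i ∸ 1) × norm1 x₂ ≤ 2 ^ (i ∸ 1) × (∀ j → x j ≡ x₁ j + x₂ j))
      × (closeToHalf (dot w x₁) (dot w x) (2 * Δ p w) × closeToHalf (dot w x₂) (dot w x) (2 * Δ p w))
      × (closeToHalf (dot p x₁) (dot p x) (2 * Δ p w) × closeToHalf (dot p x₂) (dot p x) (2 * Δ p w))
lemma3p3 n p w (suc k) (s≤s z≤n) x ‖x‖≤2K =
  count left , count right ,
  (norm1-≤ left (proj₁ lengths) , norm1-≤ right (proj₂ lengths) , x≗x₁+x₂) ,
  halves⇒closeToHalf (2 * Δ p w) w x left right x≗x₁+x₂ near-g (≤Δ⇒≤4Δ (m≤n+m _ _)) ,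
  halves⇒closeToHalf (2 * Δ p w) p x left right x≗x₁+x₂ near-f (≤Δ⇒≤4Δ (m≤m+n _ _))
  where
  H : Halves p w (≤-maxᶠ n p) (items x) (maxᶠ n w)
  H = halves p w (≤-maxᶠ n p) (items x) (All.universal (≤-maxᶠ n w) (items x))
  open Halves H
  x≗x₁+x₂ : ∀ j → x j ≡ count left j + count right j
  x≗x₁+x₂ j = sym (trans (sym (count-++ left right j)) (trans (count-↭ left++right↭ j) (count-items x j)))
  lengths : length left ≤ 2 ^ k × length right ≤ 2 ^ k
  lengths = length-halves-≤ p w (≤-maxᶠ n p) H (≤-trans (≤-reflexive (length-items x)) ‖x‖≤2K)
  norm1-≤ : ∀ L → length L ≤ 2 ^ k → norm1 (count L) ≤ 2 ^ k
  norm1-≤ L = subst (_≤ 2 ^ k) (sym (norm1-count L))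
  ≤Δ⇒≤4Δ : ∀ {K} → K ≤ Δ p w → K ≤ 2 * (2 * Δ p w)
  ≤Δ⇒≤4Δ K≤Δ = ≤-trans K≤Δ (≤-trans (m≤n*m (Δ p w) 2) (m≤n*m (2 * Δ p w) 2))
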